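{- Let $k\ge0$, let $\mathcal{M}$ be a pointed model and let $\mathcal{M}'=(M',w'_d)$ be its rooted $k$-contraction. If $x \neq y$ are worlds of $\mathcal{M}'$ whose bounds in $\mathcal{M}'$ satisfy $b(x) = b(y) = h$, then $(M',x)$ and $(M',y)$ are not $h$-bisimilar.
   Context: Fix a countable set $\mathcal{P}$ of atomic propositions and a finite set $\mathcal{I}$ of modality indices. A model is $M=(W,R,V)$ with $W$ finite nonempty, $R_i\subseteq W\times W$ for $i\in\mathcal{I}$, $V:\mathcal{P}\to2^W$; a pointed model is $(M,w_d)$ with $w_d\in W$. $\sim_h$ denotes standard $h$-bounded bisimilarity; for worlds of one model, $w\sim_hv$ means $(M,w)\sim_h(M,v)$, and $[w]_h=\{v\in W\mid w\sim_hv\}$. For any pointed model and the fixed $k$: depth $d(w)$ = length of a shortest path from the designated world to $w$ along edges of any $R_i$ ($\infty$ if none); bound $b(w)=k-d(w)$ (computed in the pointed model to which $w$ belongs). For $x,y$ with nonnegative bound, $x\succ y$ iff $b(x)>b(y)$ and $x\sim_{b(y)}y$. $\mathrm{Max}(W)=\{x\in W\mid b(x)\ge0$ and no $y\in W$ has $y\succ x\}$. The rooted $k$-contraction of $\mathcal{M}=((W,R,V),w_d)$ is $((W',R',V'),[w_d]_{b(w_d)})$ with $W'=\{[x]_{b(x)}\mid x\in\mathrm{Max}(W)\}$, $R'_i=\{([x]_{b(x)},[y]_{b(y)})\mid x,y\in\mathrm{Max}(W),\ \exists z\,(xR_iz\text{ and }y\sim_{b(x)-1}z),\ b(x)>0\}$,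 $V'(p)=\{[x]_{b(x)}\mid x\in\mathrm{Max}(W),\ x\in V(p)\}$ (bounds here taken in $\mathcal{M}$). -}

module Defs where

open import Data.Nat using (ℕ; zero; suc; _+_; _<_; _≤_; s≤s; z≤n)
open import Data.Nat.Properties using (m≤n+m; <-irrefl; ≤-trans)
open import Data.Fin using (Fin)
open import Data.Product using (Σ; ∃-syntax; _×_; _,_)
open import Relation.Nullary using (¬_)
open import Relation.Binary.PropositionalEquality using (_≡_; refl; subst; sym)
open import Function.Bundles using (_⇔_)

-- Modality indices: Fin m (a finite set I).  Atomic propositions: ℕ (countable P).
-- A (Kripke) model over a carrier W; valuations are predicates (V p ⊆ W).
record Model (m : ℕ) (W : Set) : Set₁ where
  field
    R : Fin m → W → W → Set
    V : ℕ → W → Set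

open Model public

Atoms : ∀ {m W W'} → Model m W → W → Model m W' → W' → Set
Atoms M w N v = ∀ p → V M p w ⇔ V N p v

Bisim : ∀ {m W W'} → ℕ → Model m W → W → Model m W' → W' → Set
Bisim zero    M w N v = Atoms M w N v
Bisim (suc h) M w N v =
  Atoms M w N v
  × (∀ i w' → R M i w w' → ∃[ v' ] (R N i v v' × Bisim h M w' N v'))
  × (∀ i v' → R N i v v' → ∃[ w' ] (R M i w w' × Bisim h M w' N v'))

data Reach {m W} (M : Model m W) (wd : W) : ℕ → W → Set where
  here : Reach M wd 0 wd
  step : ∀ {n u v} (i : Fin m) → Reach M wd n u → R M i u v → Reach M wd (suc n) v

-- Depth: d(w) = d  (shortest path length; worlds of infinite depth satisfy no Depth _ d).
Depth : ∀ {m W} → Model m W → W → W → ℕ → Set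
Depth M wd w d = Reach M wd d w × (∀ d' → d' < d → ¬ Reach M wd d' w)

-- HasBound k M wd w h : b(w) = k - d(w) equals the nonnegative integer h.
HasBound : ∀ {m W} → ℕ → Model m W → W → W → ℕ → Set
HasBound k M wd w h = ∃[ d ] (Depth M wd w d × d + h ≡ k)

module Contraction {m n : ℕ} (k : ℕ) (M : Model m (Fin n)) (wd : Fin n) where

  Bd : Fin n → ℕ → Set
  Bd = HasBound k M wd

  _≻_ : Fin n → Fin n → Set
  x ≻ y = ∃[ hx ] ∃[ hy ] (Bd x hx × Bd y hy × hy < hx × Bisim hy M x M y)

  IsMax : Fin n → Set
  IsMax x = (∃[ h ] Bd x h) × ¬ (∃[ y ] (y ≻ x))

  Cls : Fin n → Fin n → Set
  Cls x v = ∃[ h ] (Bd x h × Bisim h M x M v)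

  SameCls : Fin n → Fin n → Set
  SameCls x y = ∀ v → Cls x v ⇔ Cls y v

  -- Worlds of M' are represented by elements of Max(W); the world represented
  -- by x is the class [x]_{b(x)}.  R' and V' are defined on classes (closed
  -- under SameCls), exactly as in the paper.
  W' : Set
  W' = Σ (Fin n) IsMax

  R' : Fin m → W' → W' → Set
  R' i (x , _) (y , _) =
    ∃[ x₀ ] ∃[ y₀ ] (IsMax x₀ × IsMax y₀ × SameCls x x₀ × SameCls y y₀
      × ∃[ z ] (R M i x₀ z × ∃[ h ] (Bd x₀ (suc h) × Bisim h M y₀ M z)))

  V' : ℕ → W' → Set
  V' p (x , _) = ∃[ x₀ ] (IsMax x₀ × SameCls x x₀ × V M p x₀)

  M' : Model m W'
  M' = record { R = R' ; V = V' }

  wd-max : IsMax wd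
  wd-max = (k , 0 , (here , λ _ ()) , refl) , noabove
    where
      noabove : ¬ (∃[ y ] (y ≻ wd))
      noabove (y , hy , hw , (dy , _ , eqy) , (zero , _ , eqw) , lt , _) =
        <-irrefl refl (subst (λ t → hw < t) (sym eqw)
          (≤-trans lt (subst (hy ≤_) eqy (m≤n+m hy dy))))
      noabove (y , hy , hw , _ , (suc d , (_ , minw) , _) , _) = minw 0 (s≤s z≤n) here

  wd' : W'
  wd' = wd , wd-max

  _≉_ : W' → W' → Set
  (x , _) ≉ (y , _) = ¬ SameCls x y

-- A world u = [x] of M' behaves in M' like x in M up to depth b(x): an M'-edge out of
-- [x] comes from an M-edge out of a ≻-maximal representative of the same class, and
-- conversely every M-edge out of x can be redirected to a maximal world dominating its
-- target.  Along M'-edges the bound of the representative drops by at most one, and every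
-- M-path is shadowed by an M'-path, so the bound of [x] in M' is b(x).  Hence an
-- h-bisimulation between [x] and [y] in M' with both bounds h yields x ∼_h y in M, and
-- maximality then forces [x]_h = [y]_h.  Existence of depths and of maximal dominating
-- worlds is classical; as the conclusion is a negation and W is finite, both may be
-- assumed for all worlds at once.
module Submission where

open import Defs
open import Data.Nat using (ℕ; zero; suc; _+_; _∸_; _<_; _≤_; s≤s)
open import Data.Nat.Induction using (<-rec)
open import Data.Nat.Properties
open import Data.Fin using (Fin)
open import Data.Fin.Properties using (sequence)
open import Data.Product using (∃-syntax; _×_; _,_; proj₁; proj₂; map₂)
open import Data.Empty using (⊥)
open import Data.Sum using (_⊎_; inj₁; inj₂)
open import Effect.Monad using (RawMonad)
open import Function.Bundles using (mk⇔; Equivalence)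
open import Function.Construct.Identity using (⇔-id)
open import Function.Construct.Symmetry using (⇔-sym)
open import Function.Construct.Composition using (_⇔-∘_)
open import Relation.Nullary using (¬_; yes; no)
open import Relation.Nullary.Decidable using (¬¬-excluded-middle)
open import Relation.Nullary.Negation using (¬¬-Monad; ¬¬-map; contradiction)
open import Relation.Binary.PropositionalEquality
  using (_≡_; refl; subst; subst₂; sym; trans; cong; module ≡-Reasoning)

¬¬-→ : ∀ {A B : Set} → (A → ¬ ¬ B) → ¬ ¬ (A → B)
¬¬-→ f κ = ¬¬-excluded-middle λ where
  (yes a) → f a (λ b → κ (λ _ → b))
  (no ¬a) → κ (λ a → contradiction a ¬a)

¬¬-∀-Fin : ∀ {n} {P : Fin n → Set} → (∀ i → ¬ ¬ P i) → ¬ ¬ (∀ i → P i)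
¬¬-∀-Fin = sequence (RawMonad.rawApplicative ¬¬-Monad)

Least : (ℕ → Set) → Set
Least P = ∃[ d ] (P d × ∀ d' → d' < d → ¬ P d')

¬¬-least : ∀ {P : ℕ → Set} d → P d → ¬ ¬ Least P
¬¬-least {P} = <-rec (λ d → P d → ¬ ¬ Least P) λ d smaller pd κ →
  ¬¬-excluded-middle {A = ∃[ d' ] (d' < d × P d')} λ where
    (yes (d' , d'<d , pd')) → smaller d'<d pd' κ
    (no none) → κ (d , pd , λ d' d'<d pd' → none (d' , d'<d , pd'))

m+n≡o≤m+p⇒n≤p : ∀ {m n o p} → m + n ≡ o → o ≤ m + p → n ≤ p
m+n≡o≤m+p⇒n≤p {m} {n} {p = p} refl = +-cancelˡ-≤ m n p

module _ {m : ℕ} where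

  Bisim⇒Atoms : ∀ {W W'} {M : Model m W} {N : Model m W'} {w v} h →
                Bisim h M w N v → Atoms M w N v
  Bisim⇒Atoms zero    a       = a
  Bisim⇒Atoms (suc h) (a , _) = a

  Bisim-refl : ∀ {W} {M : Model m W} {w} h → Bisim h M w M w
  Bisim-refl zero    p = ⇔-id _
  Bisim-refl (suc h) =
    (λ _ → ⇔-id _) , (λ i w' r → w' , r , Bisim-refl h) , (λ i w' r → w' , r , Bisim-refl h)

  Bisim-sym : ∀ {W W'} {M : Model m W} {N : Model m W'} {w v} h →
              Bisim h M w N v → Bisim h N v M w
  Bisim-sym zero    a p = ⇔-sym (a p)
  Bisim-sym (suc h) (a , forth , back) =
    (λ p → ⇔-sym (a p)) ,
    (λ i v' r → map₂ (map₂ (Bisim-sym h)) (back i v' r)) ,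
    (λ i w' r → map₂ (map₂ (Bisim-sym h)) (forth i w' r))

  Bisim-trans : ∀ {W W' W''} {M : Model m W} {N : Model m W'} {O : Model m W''} {w v u} h →
                Bisim h M w N v → Bisim h N v O u → Bisim h M w O u
  Bisim-trans zero a b p = b p ⇔-∘ a p
  Bisim-trans {M = M} {O = O} (suc h) (a , forth , back) (a' , forth' , back') =
    (λ p → a' p ⇔-∘ a p) , forth″ , back″
    where
      forth″ : ∀ i w' → R M i _ w' → ∃[ u' ] (R O i _ u' × Bisim h M w' O u')
      forth″ i w' r =
        let v' , r' , w'∼v' = forth i w' r
        in map₂ (map₂ (Bisim-trans h w'∼v')) (forth' i v' r')
      back″ : ∀ i u' → R O i _ u' → ∃[ w' ] (R M i _ w' × Bisim h M w' O u')
      back″ i u' r =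
        let v' , r' , v'∼u' = back' i u' r
        in map₂ (map₂ (λ w'∼v' → Bisim-trans h w'∼v' v'∼u')) (back i v' r')

  Bisim-mono : ∀ {W W'} {M : Model m W} {N : Model m W'} {w v h h'} →
               h' ≤ h → Bisim h M w N v → Bisim h' M w N v
  Bisim-mono {h = h} {zero} _ w∼v = Bisim⇒Atoms h w∼v
  Bisim-mono {h = suc h} {suc h'} (s≤s h'≤h) (a , forth , back) =
    a ,
    (λ i w' r → map₂ (map₂ (Bisim-mono h'≤h)) (forth i w' r)) ,
    (λ i v' r → map₂ (map₂ (Bisim-mono h'≤h)) (back i v' r))

Reachable : ∀ {m W} → Model m W → W → W → Set
Reachable M wd w = ∃[ d ] Reach M wd d w

HasDepth : ∀ {m W} → Model m W → W → W → Set
HasDepth M wd w = ∃[ d ] Depth M wd w d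

module _ {m} {W : Set} {M : Model m W} {wd : W} where

  ¬¬reachable⇒depth : ∀ w → ¬ ¬ (Reachable M wd w → HasDepth M wd w)
  ¬¬reachable⇒depth w = ¬¬-→ λ (d , r) → ¬¬-least d r

  Reach-zero : ∀ {w} → Reach M wd 0 w → w ≡ wd
  Reach-zero here = refl

  Depth-minimal : ∀ {w d d'} → Depth M wd w d → Reach M wd d' w → d ≤ d'
  Depth-minimal (_ , minimal) r = ≮⇒≥ (λ d'<d → minimal _ d'<d r)

  Depth-unique : ∀ {w d₁ d₂} → Depth M wd w d₁ → Depth M wd w d₂ → d₁ ≡ d₂
  Depth-unique p q = ≤-antisym (Depth-minimal p (proj₁ q)) (Depth-minimal q (proj₁ p))

  HasBound-unique : ∀ {k w h₁ h₂} → HasBound k M wd w h₁ → HasBound k M wd w h₂ → h₁ ≡ h₂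
  HasBound-unique (d₁ , p₁ , e₁) (d₂ , p₂ , e₂) with Depth-unique p₁ p₂
  ... | refl = +-cancelˡ-≡ d₁ _ _ (trans e₁ (sym e₂))

  HasBound-≤ : ∀ {k w h} → HasBound k M wd w h → h ≤ k
  HasBound-≤ {h = h} (d , _ , e) = subst (h ≤_) e (m≤n+m h d)

  HasBound-Reach : ∀ {k w h d} → HasBound k M wd w h → Reach M wd d w → k ≤ d + h
  HasBound-Reach {h = h} (_ , p , e) r = subst (_≤ _) e (+-monoˡ-≤ h (Depth-minimal p r))

  successor-bound : (∀ w → Reachable M wd w → HasDepth M wd w) →
                    ∀ {k u v h i} → HasBound k M wd u (suc h) → R M i u v →
                    ∃[ hv ] (HasBound k M wd v hv × h ≤ hv)
  successor-bound depth {k} {v = v} {h} {i} (du , (ru , _) , e) r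
    with depth v (suc du , step i ru r)
  ... | dv , pv = suc du ∸ dv + h , (dv , pv , bound-eq) , m≤n+m h _
    where
      dv≤ : dv ≤ suc du
      dv≤ = Depth-minimal pv (step i ru r)
      open ≡-Reasoning
      bound-eq : dv + (suc du ∸ dv + h) ≡ k
      bound-eq = begin
        dv + (suc du ∸ dv + h) ≡⟨ sym (+-assoc dv _ h) ⟩
        dv + (suc du ∸ dv) + h ≡⟨ cong (_+ h) (m+[n∸m]≡n dv≤) ⟩
        suc du + h             ≡⟨ sym (+-suc du h) ⟩
        du + suc h             ≡⟨ e ⟩
        k                      ∎

module _ {m n : ℕ} (k : ℕ) (M : Model m (Fin n)) (wd : Fin n) where
  open Contraction k M wd

  -- The bound in M of the representative, not the bound in M'.
  bound : W' → ℕ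
  bound (_ , (b , _) , _) = b

  bound-correct : (u : W') → Bd (proj₁ u) (bound u)
  bound-correct (_ , (_ , bd) , _) = bd

  SameCls-refl : ∀ {x} → SameCls x x
  SameCls-refl v = ⇔-id _

  SameCls-sym : ∀ {x y} → SameCls x y → SameCls y x
  SameCls-sym x≈y v = ⇔-sym (x≈y v)

  SameCls-trans : ∀ {x y z} → SameCls x y → SameCls y z → SameCls x z
  SameCls-trans x≈y y≈z v = y≈z v ⇔-∘ x≈y v

  Cls-self : ∀ {x b} → Bd x b → Cls x x
  Cls-self {b = b} bd = b , bd , Bisim-refl b

  Cls⇒Bisim : ∀ {x v b} → Bd x b → Cls x v → Bisim b M x M v
  Cls⇒Bisim {x} {v} bd (_ , bd' , x∼v) =
    subst (λ h → Bisim h M x M v) (HasBound-unique bd' bd) x∼v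

  Bisim⇒SameCls : ∀ {x y b} → Bd x b → Bd y b → Bisim b M x M y → SameCls x y
  Bisim⇒SameCls {b = b} bdx bdy x∼y v =
    mk⇔ (λ x∋v → b , bdy , Bisim-trans b (Bisim-sym b x∼y) (Cls⇒Bisim bdx x∋v))
        (λ y∋v → b , bdx , Bisim-trans b x∼y (Cls⇒Bisim bdy y∋v))

  max-bisim⇒bound≤ : ∀ {x z bx bz} → IsMax x → Bd x bx → Bd z bz →
                     Bisim bx M x M z → bz ≤ bx
  max-bisim⇒bound≤ {z = z} {bx} (_ , nothing-above) bdx bdz x∼z =
    ≮⇒≥ (λ bx<bz → nothing-above (z , _ , _ , bdz , bdx , bx<bz , Bisim-sym bx x∼z))

  max-bisim⇒≤bound : ∀ {x z bx bz h} → IsMax x → Bd x bx → Bd z bz → h ≤ bz →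
                     Bisim h M x M z → h ≤ bx
  max-bisim⇒≤bound mx bdx bdz h≤bz x∼z =
    ≮⇒≥ (λ bx<h → <⇒≱ (<-≤-trans bx<h h≤bz)
                       (max-bisim⇒bound≤ mx bdx bdz (Bisim-mono (<⇒≤ bx<h) x∼z)))

  SameCls⇒bound≡ : (u v : W') → SameCls (proj₁ u) (proj₁ v) → bound u ≡ bound v
  SameCls⇒bound≡ u v u≈v = ≤-antisym
    (max-bisim⇒bound≤ (proj₂ v) (bound-correct v) (bound-correct u)
      (Cls⇒Bisim (bound-correct v) (Equivalence.to (u≈v (proj₁ u)) (Cls-self (bound-correct u)))))
    (max-bisim⇒bound≤ (proj₂ u) (bound-correct u) (bound-correct v)
      (Cls⇒Bisim (bound-correct u) (Equivalence.from (u≈v (proj₁ v)) (Cls-self (bound-correct v)))))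

  SameCls⇒Bisim : (u v : W') → SameCls (proj₁ u) (proj₁ v) →
                  Bisim (bound u) M (proj₁ u) M (proj₁ v)
  SameCls⇒Bisim u v u≈v =
    Cls⇒Bisim (bound-correct u) (Equivalence.from (u≈v (proj₁ v)) (Cls-self (bound-correct v)))

  MaxAbove : Fin n → ℕ → Set
  MaxAbove z b = ∃[ u ] (b ≤ bound u × Bisim b M (proj₁ u) M z)

  -- Climb along ≻ from z: each step raises the bound, which never exceeds k.
  ¬¬maxAbove : ∀ f {z b} → k ∸ b < f → Bd z b → ¬ ¬ MaxAbove z b
  ¬¬maxAbove (suc f) {z} {b} gap<f bd κ =
    ¬¬-excluded-middle {A = ∃[ y ] (y ≻ z)} λ where
      (no nothing-above) → κ ((z , (b , bd) , nothing-above) , ≤-refl , Bisim-refl b)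
      (yes (y , hy , hz , bdy , bdz , hz<hy , y∼z)) →
        climb y hy (subst (_< hy) (HasBound-unique bdz bd) hz<hy) bdy
          (subst (λ h → Bisim h M y M z) (HasBound-unique bdz bd) y∼z)
    where
      climb : ∀ y hy → b < hy → Bd y hy → Bisim b M y M z → ⊥
      climb y hy b<hy bdy y∼z =
        ¬¬maxAbove f (<-≤-trans (∸-monoʳ-< b<hy (HasBound-≤ bdy)) (≤-pred gap<f)) bdy
          λ (u , hy≤u , u∼y) →
            κ (u , ≤-trans (<⇒≤ b<hy) hy≤u , Bisim-trans b (Bisim-mono (<⇒≤ b<hy) u∼y) y∼z)

  ¬¬maxAbove-everywhere : ∀ z → ¬ ¬ (∀ b → Bd z b → MaxAbove z b)
  ¬¬maxAbove-everywhere z = ¬¬-map (λ f b bd → f (b , bd) b bd) (¬¬-→ λ (b , bd) →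
    ¬¬-map (λ above b' bd' → subst (MaxAbove z) (HasBound-unique bd bd') above)
           (¬¬maxAbove (suc (k ∸ b)) ≤-refl bd))

  module _ (depth : ∀ z → Reachable M wd z → HasDepth M wd z)
           (maxAbove : ∀ z b → Bd z b → MaxAbove z b) where

    R'-forth : ∀ {i} (u w : W') → R' i u w →
               ∃[ h ] (bound u ≡ suc h × h ≤ bound w ×
                       ∃[ z ] (R M i (proj₁ u) z × Bisim h M (proj₁ w) M z))
    R'-forth {i} u w (x₀ , y₀ , mx₀ , my₀ , u≈x₀ , w≈y₀ , z , x₀z , h , bdx₀ , y₀∼z) =
      let hz , bdz , h≤hz = successor-bound depth bdx₀ x₀z
          z' , uz' , z'∼z = proj₂ (proj₂ u∼u₀) i z x₀z
          h≤w : h ≤ bound w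
          h≤w = subst (h ≤_) (sym (SameCls⇒bound≡ w w₀ w≈y₀))
                  (max-bisim⇒≤bound my₀ (bound-correct w₀) bdz h≤hz y₀∼z)
      in h , u≡ , h≤w , z' , uz' ,
         Bisim-trans h (Bisim-mono h≤w (SameCls⇒Bisim w w₀ w≈y₀))
           (Bisim-trans h y₀∼z (Bisim-sym h z'∼z))
      where
        u₀ w₀ : W'
        u₀ = x₀ , mx₀
        w₀ = y₀ , my₀
        u≡ : bound u ≡ suc h
        u≡ = trans (SameCls⇒bound≡ u u₀ u≈x₀) (HasBound-unique (bound-correct u₀) bdx₀)
        u∼u₀ : Bisim (suc h) M (proj₁ u) M x₀
        u∼u₀ = Bisim-mono (≤-reflexive (sym u≡)) (SameCls⇒Bisim u u₀ u≈x₀)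

    R'-back : ∀ {i h z} (u : W') → suc h ≤ bound u → R M i (proj₁ u) z →
              ∃[ w ] (R' i u w × h ≤ bound w × Bisim h M (proj₁ w) M z)
    R'-back {z = z} (x , (suc b , bdx) , nothing-above) (s≤s h≤b) xz =
      let hz , bdz , b≤hz = successor-bound depth bdx xz
          w , hz≤w , w∼z = maxAbove z hz bdz
          h≤hz = ≤-trans h≤b b≤hz
      in w ,
         (x , proj₁ w , ((suc b , bdx) , nothing-above) , proj₂ w , SameCls-refl , SameCls-refl ,
          z , xz , b , bdx , Bisim-mono b≤hz w∼z) ,
         ≤-trans h≤hz hz≤w , Bisim-mono h≤hz w∼z

    Atoms-contraction : (u : W') → Atoms M' u M (proj₁ u)
    Atoms-contraction u p =
      mk⇔ (λ (x₀ , mx₀ , u≈x₀ , px₀) →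
             Equivalence.from (Bisim⇒Atoms _ (SameCls⇒Bisim u (x₀ , mx₀) u≈x₀) p) px₀)
          (λ pu → proj₁ u , proj₂ u , SameCls-refl , pu)

    Bisim-contraction : ∀ h (u : W') → h ≤ bound u → Bisim h M' u M (proj₁ u)
    Bisim-contraction zero    u _   = Atoms-contraction u
    Bisim-contraction (suc h) u h<u = Atoms-contraction u , forth , back
      where
        forth : ∀ i w → R' i u w → ∃[ z ] (R M i (proj₁ u) z × Bisim h M' w M z)
        forth i w uw =
          let h' , u≡ , h'≤w , z , uz , w∼z = R'-forth u w uw
              h≤h' = ≤-pred (subst (suc h ≤_) u≡ h<u)
          in z , uz , Bisim-trans h (Bisim-contraction h w (≤-trans h≤h' h'≤w)) (Bisim-mono h≤h' w∼z)
        back : ∀ i z → R M i (proj₁ u) z → ∃[ w ] (R' i u w × Bisim h M' w M z)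
        back i z uz =
          let w , uw , h≤w , w∼z = R'-back u h<u uz
          in w , uw , Bisim-trans h (Bisim-contraction h w h≤w) w∼z

    R'-bound : ∀ {i} (u w : W') → R' i u w → bound u ≤ suc (bound w)
    R'-bound u w uw =
      let h , u≡ , h≤w , _ = R'-forth u w uw
      in subst (_≤ suc (bound w)) (sym u≡) (s≤s h≤w)

    Reach-contraction-bound : ∀ {d w} → Reach M' wd' d w → k ≤ d + bound w
    Reach-contraction-bound here = ≤-refl
    Reach-contraction-bound (step {d} {u} {w} i r uw) =
      ≤-trans (Reach-contraction-bound r)
        (subst (d + bound u ≤_) (+-suc d (bound w)) (+-monoʳ-≤ d (R'-bound u w uw)))

    Reach-lift : ∀ {d z} e → Reach M wd d z → d + e ≡ k →
                 ∃[ u ] (Reach M' wd' d u × e ≤ bound u × Bisim e M (proj₁ u) M z)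
    Reach-lift e here refl = wd' , here , ≤-refl , Bisim-refl e
    Reach-lift e (step {d} {z} {z'} i r zz') eq =
      let u , ru , e<u , u∼z = Reach-lift (suc e) r (trans (+-suc d e) eq)
          x' , ux' , x'∼z' = proj₂ (proj₂ u∼z) i z' zz'
          w , uw , e≤w , w∼x' = R'-back u e<u ux'
      in w , step i ru uw , e≤w , Bisim-trans e w∼x' x'∼z'

    Reach-contraction-resp-SameCls : ∀ {d} (u v : W') → Reach M' wd' (suc d) u →
                                     SameCls (proj₁ u) (proj₁ v) → Reach M' wd' (suc d) v
    Reach-contraction-resp-SameCls u v (step i r (x₀ , y₀ , mx₀ , my₀ , a≈x₀ , u≈y₀ , rest)) u≈v =
      step i r (x₀ , y₀ , mx₀ , my₀ , a≈x₀ , SameCls-trans (SameCls-sym u≈v) u≈y₀ , rest)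

    HasBound-contraction-≤ : ∀ {h} (u : W') → HasBound k M' wd' u h → h ≤ bound u
    HasBound-contraction-≤ u (d , (r , _) , e) = m+n≡o≤m+p⇒n≤p e (Reach-contraction-bound r)

    -- The designated world may occur in W' with a maximality proof other than the one
    -- in wd', and is then not reached from wd' in 0 steps.
    HasBound-contraction-≥ : ∀ {h} (u : W') → HasBound k M' wd' u h → proj₁ u ≡ wd ⊎ bound u ≤ h
    HasBound-contraction-≥ u hb with bound-correct u
    ... | zero  , (r , _) , _ = inj₁ (Reach-zero r)
    ... | suc d , (r , _) , e =
      let v , rv , u≤v , v∼u = Reach-lift (bound u) r e
          v≤u = max-bisim⇒bound≤ (proj₂ u) (bound-correct u) (bound-correct v) (Bisim-sym _ v∼u)
          v≈u = Bisim⇒SameCls (subst (Bd (proj₁ v)) (≤-antisym v≤u u≤v) (bound-correct v))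
                              (bound-correct u) v∼u
      in inj₂ (m+n≡o≤m+p⇒n≤p e (HasBound-Reach hb (Reach-contraction-resp-SameCls v u rv v≈u)))

    max-bisim⇒SameCls : ∀ h (u v : W') → bound u ≡ h → h ≤ bound v →
                        Bisim h M (proj₁ u) M (proj₁ v) → SameCls (proj₁ u) (proj₁ v)
    max-bisim⇒SameCls h u v refl h≤v u∼v =
      Bisim⇒SameCls (bound-correct u)
        (subst (Bd (proj₁ v)) (≤-antisym v≤u h≤v) (bound-correct v)) u∼v
      where
        v≤u = max-bisim⇒bound≤ (proj₂ u) (bound-correct u) (bound-correct v) u∼v

    contraction-separated : ∀ (x y : W') h → x ≉ y →
                            HasBound k M' wd' x h → HasBound k M' wd' y h → ¬ Bisim h M' x M' y
    contraction-separated x y h x≉y hx hy x∼y =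
      x≉y (separate (HasBound-contraction-≥ x hx) (HasBound-contraction-≥ y hy))
      where
        h≤x = HasBound-contraction-≤ x hx
        h≤y = HasBound-contraction-≤ y hy
        x∼y-in-M : Bisim h M (proj₁ x) M (proj₁ y)
        x∼y-in-M = Bisim-trans h (Bisim-sym h (Bisim-contraction h x h≤x))
                     (Bisim-trans h x∼y (Bisim-contraction h y h≤y))
        separate : proj₁ x ≡ wd ⊎ bound x ≤ h → proj₁ y ≡ wd ⊎ bound y ≤ h →
                   SameCls (proj₁ x) (proj₁ y)
        separate (inj₂ x≤h) _ = max-bisim⇒SameCls h x y (≤-antisym x≤h h≤x) h≤y x∼y-in-M
        separate (inj₁ _) (inj₂ y≤h) =
          SameCls-sym (max-bisim⇒SameCls h y x (≤-antisym y≤h h≤y) h≤x (Bisim-sym h x∼y-in-M))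
        separate (inj₁ x≡wd) (inj₁ y≡wd) = subst₂ SameCls (sym x≡wd) (sym y≡wd) SameCls-refl

corollary4p3 : ∀ {m n : ℕ} (k : ℕ) (M : Model m (Fin n)) (wd : Fin n)
    → let open Contraction k M wd in
      ∀ (x y : W') (h : ℕ)
    → x ≉ y
    → HasBound k M' wd' x h
    → HasBound k M' wd' y h
    → ¬ Bisim h M' x M' y
corollary4p3 k M wd x y h x≉y hx hy x∼y =
  ¬¬-∀-Fin ¬¬reachable⇒depth λ depth →
  ¬¬-∀-Fin (¬¬maxAbove-everywhere k M wd) λ maxAbove →
  contraction-separated k M wd depth maxAbove x y h x≉y hx hy x∼y
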